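{- For every $m\ge 0$, $D^{sc}_f(Q_{m+3};Q_m)\le m+4$.
   Context: The $n$-dimensional hypercube $Q_n$ is the graph whose vertices are the binary strings of length $n$, two vertices being adjacent iff they differ in exactly one position; $Q_0$ is a single vertex. The diameter of a graph is the maximum graph distance between two of its vertices. For $0\le k\le n$, a $k$-subcube of $Q_n$ is a vertex set $U\subseteq V(Q_n)$ whose induced subgraph is isomorphic to $Q_k$. $\kappa^{sc}(Q_n;Q_m)$ is the minimum number of pairwise disjoint vertex sets, each a $k$-subcube of $Q_n$ for some $0\le k\le m$, whose deletion disconnects $Q_n$. $D^{sc}_f(Q_n;Q_m)$ is the maximum diameter of $Q_n-\bigcup\mathcal{F}$ over all families $\mathcal{F}$ of at most $\kappa^{sc}(Q_n;Q_m)-1$ pairwise disjoint vertex sets, each a $k$-subcube of $Q_n$ for some $0\le k\le m$. -}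

module Defs where

open import Data.Nat using (ℕ; zero; suc; _+_; _≤_; _<_)
open import Data.Bool using (Bool; true; false; _≟_)
open import Data.Vec using (Vec; []; _∷_)
open import Data.List using (List; length)
open import Data.List.Relation.Unary.Any using (Any)
open import Data.List.Relation.Unary.AllPairs using (AllPairs)
open import Data.Product using (Σ; ∃; _×_; _,_; proj₁)
open import Relation.Nullary using (¬_)
open import Relation.Binary.PropositionalEquality using (_≡_)
open import Function.Bundles using (_⇔_)

Vertex : ℕ → Set
Vertex n = Vec Bool n

hamming : ∀ {n} → Vertex n → Vertex n → ℕ
hamming [] [] = 0
hamming (a ∷ u) (b ∷ v) with a ≟ b
... | Relation.Nullary.yes _ = hamming u v
... | Relation.Nullary.no  _ = suc (hamming u v)

Adj : ∀ {n} → Vertex n → Vertex n → Set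
Adj u v = hamming u v ≡ 1

VSet : ℕ → Set
VSet n = Vertex n → Bool

-- U is a k-subcube of Q_n: the subgraph of Q_n induced by U is isomorphic to Q_k,
-- witnessed by an injective map f : V(Q_k) → V(Q_n) with image exactly U that
-- preserves and reflects adjacency.
IsSubcube : (n k : ℕ) → VSet n → Set
IsSubcube n k U =
  Σ (Vertex k → Vertex n) λ f →
    (∀ x y → f x ≡ f y → x ≡ y) ×
    (∀ v → (U v ≡ true) ⇔ (∃ λ x → f x ≡ v)) ×
    (∀ x y → Adj x y ⇔ Adj (f x) (f y))

SC : (n m : ℕ) → Set
SC n m = Σ (VSet n) λ U → ∃ λ k → k ≤ m × IsSubcube n k U

Disjoint : ∀ {n m} → SC n m → SC n m → Set
Disjoint (U , _) (V , _) = ∀ v → U v ≡ true → V v ≡ false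

PairwiseDisjoint : ∀ {n m} → List (SC n m) → Set
PairwiseDisjoint F = AllPairs Disjoint F

Deleted : ∀ {n m} → List (SC n m) → Vertex n → Set
Deleted F v = Any (λ S → proj₁ S v ≡ true) F

data Walk {n : ℕ} (S : Vertex n → Set) : Vertex n → Vertex n → ℕ → Set where
  here : ∀ {u} → ¬ S u → Walk S u u 0
  step : ∀ {u w v ℓ} → ¬ S u → Adj u w → Walk S w v ℓ → Walk S u v (suc ℓ)

Disconnected : ∀ {n} → (Vertex n → Set) → Set
Disconnected S = ∃ λ u → ∃ λ v → ¬ S u × ¬ S v × (∀ ℓ → ¬ Walk S u v ℓ)

DiamLe : ∀ {n} → (Vertex n → Set) → ℕ → Set
DiamLe S d = ∀ u v → ¬ S u → ¬ S v → ∃ λ ℓ → ℓ ≤ d × Walk S u v ℓ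

-- κ is κ^{sc}(Q_n ; Q_m): the minimum size of a disconnecting family of
-- pairwise disjoint subcubes of dimension ≤ m.
IsKappa : (n m κ : ℕ) → Set
IsKappa n m κ =
  (∃ λ (G : List (SC n m)) → PairwiseDisjoint G × Disconnected (Deleted G) × length G ≡ κ) ×
  (∀ (G : List (SC n m)) → PairwiseDisjoint G → Disconnected (Deleted G) → κ ≤ length G)

-- D^{sc}_f(Q_n ; Q_m) ≤ d.
DscfLe : (n m d : ℕ) → Set
DscfLe n m d = ∀ κ → IsKappa n m κ →
  ∀ (F : List (SC n m)) → PairwiseDisjoint F → suc (length F) ≤ κ →
  DiamLe (Deleted F) d

-- A subcube of Q_n consists of the vertices agreeing with a base vertex outside a set D of
-- free coordinates; by induction on k, the image of an adjacency-preserving injection Q_k → Q_n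
-- is such a cube with |D| ≤ k. The three m-subcubes with prefixes 100, 010, 001 cut off the
-- facet 000, so κ ≤ 3 and at most two subcubes A, B are deleted, each with at least three fixed
-- coordinates. For u, v outside A ∪ B: if u agrees with v on a fixed coordinate of a cube where
-- v differs from the cube, no geodesic from u to v meets that cube, and toggling one coordinate
-- where u and v differ can create such a coordinate. So a geodesic avoids A ∪ B unless both
-- escapes from u lead into the other cube; then one step along a third fixed coordinate of A
-- reaches a vertex whose escape is open, and u, v are at distance at most n + 1 = m + 4.
module Submission where

open import Defs
open import Data.Nat using (ℕ; zero; suc; _+_; _≤_; _<_; z≤n; s≤s)
open import Data.Nat.Properties using (+-monoʳ-≤; ≤-refl; ≤-trans; +-comm; n≤1+n; suc-injective; <⇒≱; m≤n⇒m≤1+n)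
open import Data.Bool using (Bool; true; false; not; _≟_; _∧_)
open import Data.Bool.Properties using (not-involutive; not-¬; ¬-not)
open import Data.Vec using ([]; _∷_; lookup; replicate; updateAt; _++_)
open import Data.Vec.Properties using (lookup∘updateAt; lookup∘updateAt′; updateAt-updateAt-local; updateAt-id; tabulate∘lookup; tabulate-cong; ++-injectiveʳ; ∷-injective)
open import Data.Fin using (Fin; zero; suc)
open import Data.Fin.Properties using (all?; ¬∀⟶∃¬) renaming (_≟_ to _≟ᶠ_)
open import Data.Fin.Subset using (Subset; _∈_; _∉_; _⊆_; _∪_; ⁅_⁆; ⊤; ∣_∣) renaming (⊥ to ∅)
open import Data.Fin.Subset.Properties using (_∈?_; ∉⊥; ∣⊥∣≡0; ∣⊤∣≡n; p⊆q⇒∣p∣≤∣q∣; x∈p∪q⁺; x∈p∪q⁻; x∈⁅x⁆; x∈⁅y⁆⇒x≡y; ∪-identityʳ; ⊆-antisym)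
open import Data.List using (List; []; _∷_)
open import Data.List.Relation.Unary.Any using (here; there)
open import Data.List.Relation.Unary.AllPairs using ([]; _∷_)
open import Data.List.Relation.Unary.All using ([]; _∷_)
open import Data.Product using (∃; _×_; _,_; proj₁; proj₂)
open import Data.Sum as Sum using (_⊎_; inj₁; inj₂; [_,_]; swap)
open import Data.Sum.Function.Propositional using (_⊎-⇔_)
open import Data.Empty using (⊥; ⊥-elim)
open import Data.Unit using (tt) renaming (⊤ to Unit)
open import Relation.Nullary using (¬_; yes; no; does; Dec; contradiction)
open import Relation.Nullary.Decidable using (¬?; _→-dec_)
open import Relation.Binary.PropositionalEquality using (_≡_; _≢_; refl; sym; trans; cong; cong₂; subst; subst₂; module ≡-Reasoning)
open import Function using (_∘_; case_of_)
open import Function.Bundles using (_⇔_; mk⇔; Equivalence)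
import Function.Properties.Equivalence as ⇔

toggle : ∀ {n} → Vertex n → Fin n → Vertex n
toggle w i = updateAt w i not

toggle-same : ∀ {n} (w : Vertex n) i → lookup (toggle w i) i ≡ not (lookup w i)
toggle-same w i = lookup∘updateAt i w

toggle-other : ∀ {n} (w : Vertex n) {i j} → j ≢ i → lookup (toggle w i) j ≡ lookup w j
toggle-other w {i} {j} j≢i = lookup∘updateAt′ j i j≢i w

toggle-involutive : ∀ {n} (w : Vertex n) i → toggle (toggle w i) i ≡ w
toggle-involutive w i = trans (updateAt-updateAt-local i w (not-involutive _)) (updateAt-id i w)

lookup-extensional : ∀ {n} {u v : Vertex n} → (∀ i → lookup u i ≡ lookup v i) → u ≡ v
lookup-extensional {u = u} {v} eq =
  trans (sym (tabulate∘lookup u)) (trans (tabulate-cong eq) (tabulate∘lookup v))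

hamming-refl : ∀ {n} (w : Vertex n) → hamming w w ≡ 0
hamming-refl [] = refl
hamming-refl (a ∷ w) with a ≟ a
... | yes _ = hamming-refl w
... | no a≢a = contradiction refl a≢a

hamming-++ : ∀ {j n} (p : Vertex j) (x y : Vertex n) → hamming (p ++ x) (p ++ y) ≡ hamming x y
hamming-++ [] x y = refl
hamming-++ (a ∷ p) x y with a ≟ a
... | yes _ = hamming-++ p x y
... | no a≢a = contradiction refl a≢a

hamming≡0⇒≡ : ∀ {n} (u v : Vertex n) → hamming u v ≡ 0 → u ≡ v
hamming≡0⇒≡ [] [] _ = refl
hamming≡0⇒≡ (a ∷ u) (b ∷ v) h with a ≟ b
... | yes refl = cong (a ∷_) (hamming≡0⇒≡ u v h)
hamming≡0⇒≡ (a ∷ u) (b ∷ v) () | no _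

hamming≤n : ∀ {n} (u v : Vertex n) → hamming u v ≤ n
hamming≤n [] [] = z≤n
hamming≤n (a ∷ u) (b ∷ v) with a ≟ b
... | yes _ = m≤n⇒m≤1+n (hamming≤n u v)
... | no _ = s≤s (hamming≤n u v)

hamming≡suc⇒differ : ∀ {n d} (u v : Vertex n) → hamming u v ≡ suc d → ∃ λ i → lookup u i ≢ lookup v i
hamming≡suc⇒differ [] [] ()
hamming≡suc⇒differ (a ∷ u) (b ∷ v) h with a ≟ b
... | yes _ = let i , uᵢ≢vᵢ = hamming≡suc⇒differ u v h in suc i , uᵢ≢vᵢ
... | no a≢b = zero , a≢b

hamming-toggle : ∀ {n} (w v : Vertex n) i → lookup w i ≢ lookup v i →
                 hamming w v ≡ suc (hamming (toggle w i) v)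
hamming-toggle (a ∷ w) (b ∷ v) zero a≢b with a ≟ b | not a ≟ b
... | yes a≡b | _ = contradiction a≡b a≢b
... | no _ | yes _ = refl
... | no _ | no not-a≢b = contradiction (sym (¬-not (a≢b ∘ sym))) not-a≢b
hamming-toggle (a ∷ w) (b ∷ v) (suc i) wᵢ≢vᵢ with a ≟ b
... | yes _ = hamming-toggle w v i wᵢ≢vᵢ
... | no _ = cong suc (hamming-toggle w v i wᵢ≢vᵢ)

Adj-toggle : ∀ {n} (w : Vertex n) i → Adj w (toggle w i)
Adj-toggle w i =
  trans (hamming-toggle w (toggle w i) i (λ eq → not-¬ refl (trans eq (toggle-same w i))))
        (cong suc (hamming-refl (toggle w i)))

Adj⇒toggle : ∀ {n} {u v : Vertex n} → Adj u v → ∃ λ i → toggle u i ≡ v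
Adj⇒toggle {u = u} {v} adj =
  let i , uᵢ≢vᵢ = hamming≡suc⇒differ u v adj
  in i , hamming≡0⇒≡ _ v (suc-injective (trans (sym (hamming-toggle u v i uᵢ≢vᵢ)) adj))

walk-start-∉ : ∀ {n} {S : Vertex n → Set} {w v ℓ} → Walk S w v ℓ → ¬ S w
walk-start-∉ (here w∉S) = w∉S
walk-start-∉ (step w∉S _ _) = w∉S

∉-∪⁅⁆⁻ : ∀ {n} {D : Subset n} {t i} → i ∉ D ∪ ⁅ t ⁆ → i ∉ D × i ≢ t
∉-∪⁅⁆⁻ {t = t} i∉ = (λ i∈ → i∉ (x∈p∪q⁺ (inj₁ i∈))) , λ { refl → i∉ (x∈p∪q⁺ (inj₂ (x∈⁅x⁆ t))) }

∉-∪⁅⁆⁺ : ∀ {n} {D : Subset n} {t i} → i ∉ D → i ≢ t → i ∉ D ∪ ⁅ t ⁆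
∉-∪⁅⁆⁺ {D = D} {t} i∉D i≢t i∈ = [ i∉D , i≢t ∘ x∈⁅y⁆⇒x≡y t ] (x∈p∪q⁻ D ⁅ t ⁆ i∈)

∣p∪⁅x⁆∣≤1+∣p∣ : ∀ {n} (p : Subset n) x → ∣ p ∪ ⁅ x ⁆ ∣ ≤ suc ∣ p ∣
∣p∪⁅x⁆∣≤1+∣p∣ (s ∷ p) zero rewrite ∪-identityʳ p with s
... | true = n≤1+n _
... | false = ≤-refl
∣p∪⁅x⁆∣≤1+∣p∣ (s ∷ p) (suc x) with s
... | true = s≤s (∣p∪⁅x⁆∣≤1+∣p∣ p x)
... | false = ∣p∪⁅x⁆∣≤1+∣p∣ p x

∣p∣<n⇒∃∉ : ∀ {n} (p : Subset n) → ∣ p ∣ < n → ∃ λ j → j ∉ p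
∣p∣<n⇒∃∉ {n} p ∣p∣<n = ¬∀⟶∃¬ n (_∈ p) (_∈? p) λ all∈ →
  <⇒≱ ∣p∣<n (subst (_≤ ∣ p ∣) (∣⊤∣≡n n) (p⊆q⇒∣p∣≤∣q∣ {p = ⊤} {q = p} (λ {x} _ → all∈ x)))

-- base may be any vertex of the cube: its free coordinates are not normalised.
record Cube (n : ℕ) : Set where
  constructor cube
  field
    free : Subset n
    base : Vertex n

open Cube

infix 4 _∈ᶜ_ _∈ᶜ?_

_∈ᶜ_ : ∀ {n} → Vertex n → Cube n → Set
w ∈ᶜ C = ∀ i → i ∉ free C → lookup w i ≡ lookup (base C) i

_∈ᶜ?_ : ∀ {n} (w : Vertex n) (C : Cube n) → Dec (w ∈ᶜ C)
w ∈ᶜ? C = all? λ i → ¬? (i ∈? free C) →-dec (lookup w i ≟ lookup (base C) i)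

base∈ᶜ : ∀ {n} (C : Cube n) → base C ∈ᶜ C
base∈ᶜ C _ _ = refl

∉ᶜ⇒witness : ∀ {n} (C : Cube n) w → ¬ w ∈ᶜ C → ∃ λ i → i ∉ free C × lookup w i ≢ lookup (base C) i
∉ᶜ⇒witness {n} C w w∉C
  with i , ¬at-i ← ¬∀⟶∃¬ n _ (λ i → ¬? (i ∈? free C) →-dec (lookup w i ≟ lookup (base C) i)) w∉C
  with i ∈? free C
... | yes i∈ = contradiction (λ i∉ → contradiction i∈ i∉) ¬at-i
... | no i∉ = i , i∉ , λ eq → ¬at-i (λ _ → eq)

∈ᶜ-point : ∀ {n} {w z : Vertex n} → w ∈ᶜ cube ∅ z → w ≡ z
∈ᶜ-point w∈ = lookup-extensional λ i → w∈ i ∉⊥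

toggle-free-∈ᶜ : ∀ {n} (C : Cube n) w {i} → i ∈ free C → w ∈ᶜ C → toggle w i ∈ᶜ C
toggle-free-∈ᶜ C w {i} i∈ w∈ j j∉ with j ≟ᶠ i
... | yes refl = contradiction i∈ j∉
... | no j≢i = trans (toggle-other w j≢i) (w∈ j j∉)

cube-split : ∀ {n} (D : Subset n) (z : Vertex n) t w →
             w ∈ᶜ cube (D ∪ ⁅ t ⁆) z ⇔ (w ∈ᶜ cube D z ⊎ w ∈ᶜ cube D (toggle z t))
cube-split D z t w = mk⇔ to from
  where
  to : w ∈ᶜ cube (D ∪ ⁅ t ⁆) z → w ∈ᶜ cube D z ⊎ w ∈ᶜ cube D (toggle z t)
  to w∈ with lookup w t ≟ lookup z t
  ... | yes wₜ≡zₜ = inj₁ agree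
    where
    agree : w ∈ᶜ cube D z
    agree i i∉ with i ≟ᶠ t
    ... | yes refl = wₜ≡zₜ
    ... | no i≢t = w∈ i (∉-∪⁅⁆⁺ i∉ i≢t)
  ... | no wₜ≢zₜ = inj₂ agree
    where
    agree : w ∈ᶜ cube D (toggle z t)
    agree i i∉ with i ≟ᶠ t
    ... | yes refl = trans (¬-not wₜ≢zₜ) (sym (toggle-same z t))
    ... | no i≢t = trans (w∈ i (∉-∪⁅⁆⁺ i∉ i≢t)) (sym (toggle-other z i≢t))
  from : w ∈ᶜ cube D z ⊎ w ∈ᶜ cube D (toggle z t) → w ∈ᶜ cube (D ∪ ⁅ t ⁆) z
  from (inj₁ w∈) i i∉ = w∈ i (proj₁ (∉-∪⁅⁆⁻ i∉))
  from (inj₂ w∈) i i∉ =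
    let i∉D , i≢t = ∉-∪⁅⁆⁻ i∉ in trans (w∈ i i∉D) (toggle-other z i≢t)

-- If s were free in H but fixed in G, the G-neighbours of a = base H and of a toggled at s
-- would disagree at s.
free-⊆-of-neighbouring : ∀ {n} (G H : Cube n) → (∀ w → w ∈ᶜ G → ¬ w ∈ᶜ H) →
                         (∀ a → a ∈ᶜ H → ∃ λ t → toggle a t ∈ᶜ G) → free H ⊆ free G
free-⊆-of-neighbouring G H disjoint neighbour {s} s∈H with s ∈? free G
... | yes s∈G = s∈G
... | no s∉G = ⊥-elim (collide (neighbour a a∈H) (neighbour (toggle a s) aₛ∈H))
  where
  a = base H
  a∈H = base∈ᶜ H
  aₛ∈H = toggle-free-∈ᶜ H a s∈H a∈H
  collide : (∃ λ t → toggle a t ∈ᶜ G) → (∃ λ t′ → toggle (toggle a s) t′ ∈ᶜ G) → ⊥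
  collide (t , b∈G) (t′ , b′∈G) with t ≟ᶠ s | t′ ≟ᶠ s
  ... | yes refl | _ = disjoint (toggle a s) b∈G aₛ∈H
  ... | _ | yes refl = disjoint a (subst (_∈ᶜ G) (toggle-involutive a s) b′∈G) a∈H
  ... | no t≢s | no t′≢s = not-¬ refl (begin
    lookup a s                        ≡⟨ toggle-other a (t≢s ∘ sym) ⟨
    lookup (toggle a t) s             ≡⟨ b∈G s s∉G ⟩
    lookup (base G) s                 ≡⟨ b′∈G s s∉G ⟨
    lookup (toggle (toggle a s) t′) s ≡⟨ toggle-other (toggle a s) (t′≢s ∘ sym) ⟩
    lookup (toggle a s) s             ≡⟨ toggle-same a s ⟩
    not (lookup a s)                  ∎)
    where open ≡-Reasoning

-- Basing the cube at f 0 makes the base of the lower half definitionally the base of the whole.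
ImageCube : ∀ {k n} → (Vertex k → Vertex n) → Subset n → Set
ImageCube {k} f D = ∀ w → w ∈ᶜ cube D (f (replicate k false)) ⇔ ∃ λ x → f x ≡ w

∃-split-head : ∀ {k} (P : Vertex (suc k) → Set) →
               ((∃ λ x → P (false ∷ x)) ⊎ (∃ λ x → P (true ∷ x))) ⇔ ∃ P
∃-split-head P = mk⇔ [ (λ (x , p) → false ∷ x , p) , (λ (x , p) → true ∷ x , p) ] λ where
  (false ∷ x , p) → inj₁ (x , p)
  (true ∷ x , p) → inj₂ (x , p)

half : ∀ {k n} → (Vertex (suc k) → Vertex n) → Bool → Vertex k → Vertex n
half f b x = f (b ∷ x)

half-injective : ∀ {k n} (f : Vertex (suc k) → Vertex n) → (∀ x y → f x ≡ f y → x ≡ y) →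
                 ∀ b x y → half f b x ≡ half f b y → x ≡ y
half-injective f inj b x y eq = proj₂ (∷-injective (inj _ _ eq))

half-preserves-Adj : ∀ {k n} (f : Vertex (suc k) → Vertex n) → (∀ x y → Adj x y → Adj (f x) (f y)) →
                     ∀ b x y → Adj x y → Adj (half f b x) (half f b y)
half-preserves-Adj f pres b x y adj = pres (b ∷ x) (b ∷ y) (trans (hamming-++ (b ∷ []) x y) adj)

ImageCube-halves : ∀ {k n} (f : Vertex (suc k) → Vertex n) → (∀ x y → f x ≡ f y → x ≡ y) →
                   (∀ x y → Adj x y → Adj (f x) (f y)) →
                   (D : Bool → Subset n) → (∀ b → ImageCube (half f b) (D b)) →
                   ∃ λ t → ImageCube f (D false ∪ ⁅ t ⁆)
ImageCube-halves {k} {n} f inj pres D halfImage = t , image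
  where
  open Equivalence using (to; from)
  x₀ = replicate k false

  halfCube : Bool → Cube n
  halfCube b = cube (D b) (half f b x₀)

  partner : ∀ b x → ∃ λ t → toggle (half f b x) t ≡ half f (not b) x
  partner b x = Adj⇒toggle (pres (b ∷ x) (not b ∷ x) (Adj-toggle (b ∷ x) zero))

  halves-disjoint : ∀ b w → w ∈ᶜ halfCube (not b) → ¬ w ∈ᶜ halfCube b
  halves-disjoint b w w∈ w∈′ with to (halfImage (not b) w) w∈ | to (halfImage b w) w∈′
  ... | x , refl | y , eq = not-¬ refl (proj₁ (∷-injective (inj _ _ eq)))

  neighbour : ∀ b a → a ∈ᶜ halfCube b → ∃ λ t → toggle a t ∈ᶜ halfCube (not b)
  neighbour b a a∈ with x , refl ← to (halfImage b a) a∈ =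
    let t , eq = partner b x in t , from (halfImage (not b) _) (x , sym eq)

  free-⊆ : ∀ b → D b ⊆ D (not b)
  free-⊆ b = free-⊆-of-neighbouring (halfCube (not b)) (halfCube b) (halves-disjoint b) (neighbour b)

  t = proj₁ (partner false x₀)

  upper-half : halfCube true ≡ cube (D false) (toggle (half f false x₀) t)
  upper-half = cong₂ cube (⊆-antisym (free-⊆ true) (free-⊆ false)) (sym (proj₂ (partner false x₀)))

  image : ImageCube f (D false ∪ ⁅ t ⁆)
  image w = ⇔.trans (cube-split (D false) (half f false x₀) t w)
           (⇔.trans (halfImage false w ⊎-⇔ subst (λ C → w ∈ᶜ C ⇔ _) upper-half (halfImage true w))
                    (∃-split-head (λ x → f x ≡ w)))

image-isCube : ∀ {n} k (f : Vertex k → Vertex n) → (∀ x y → f x ≡ f y → x ≡ y) →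
               (∀ x y → Adj x y → Adj (f x) (f y)) → ∃ λ D → ∣ D ∣ ≤ k × ImageCube f D
image-isCube {n} zero f _ _ = ∅ , subst (_≤ 0) (sym (∣⊥∣≡0 n)) z≤n , λ w →
  mk⇔ (λ w∈ → [] , sym (∈ᶜ-point w∈)) λ { ([] , refl) → base∈ᶜ (cube ∅ (f [])) }
image-isCube (suc k) f inj pres =
  let IH b = image-isCube k (half f b) (half-injective f inj b) (half-preserves-Adj f pres b)
      D = proj₁ ∘ IH
      t , image = ImageCube-halves f inj pres D (proj₂ ∘ proj₂ ∘ IH)
  in D false ∪ ⁅ t ⁆ , ≤-trans (∣p∪⁅x⁆∣≤1+∣p∣ (D false) t) (s≤s (proj₁ (proj₂ (IH false)))) , image

Codim≥3 : ∀ {n} → Cube n → Set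
Codim≥3 {n} C = ∀ (x y : Fin n) → ∃ λ j → j ∉ free C × j ≢ x × j ≢ y

codim≥3 : ∀ {n} (C : Cube n) → 3 + ∣ free C ∣ ≤ n → Codim≥3 C
codim≥3 C 3+∣D∣≤n x y =
  let j , j∉ = ∣p∣<n⇒∃∉ ((free C ∪ ⁅ x ⁆) ∪ ⁅ y ⁆) (≤-trans (s≤s ∣D∪x∪y∣≤2+∣D∣) 3+∣D∣≤n)
      j∉D∪x , j≢y = ∉-∪⁅⁆⁻ j∉
      j∉D , j≢x = ∉-∪⁅⁆⁻ j∉D∪x
  in j , j∉D , j≢x , j≢y
  where
  ∣D∪x∪y∣≤2+∣D∣ : ∣ (free C ∪ ⁅ x ⁆) ∪ ⁅ y ⁆ ∣ ≤ 2 + ∣ free C ∣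
  ∣D∪x∪y∣≤2+∣D∣ = ≤-trans (∣p∪⁅x⁆∣≤1+∣p∣ (free C ∪ ⁅ x ⁆) y) (s≤s (∣p∪⁅x⁆∣≤1+∣p∣ (free C) x))

Separates : ∀ {n} → Cube n → Vertex n → Fin n → Set
Separates C v i = i ∉ free C × lookup v i ≢ lookup (base C) i

-- No geodesic from w to v meets C: it never toggles coord, where it keeps the value of v.
record Shielded {n} (C : Cube n) (w v : Vertex n) : Set where
  constructor shielded
  field
    coord : Fin n
    separates : Separates C v coord
    agrees : lookup w coord ≡ lookup v coord

record ApproachesAt {n} (C : Cube n) (w v : Vertex n) (i : Fin n) : Set where
  constructor approaches
  field
    separates : Separates C v i
    differs : lookup w i ≢ lookup v i

open ApproachesAt using (differs)

separates⇒∉ᶜ : ∀ {n} (C : Cube n) w {i} → Separates C w i → ¬ w ∈ᶜ C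
separates⇒∉ᶜ C w (i∉ , wᵢ≢) w∈ = wᵢ≢ (w∈ _ i∉)

shielded⇒∉ᶜ : ∀ {n} {C : Cube n} {w v} → Shielded C w v → ¬ w ∈ᶜ C
shielded⇒∉ᶜ {C = C} {w} (shielded i (i∉ , vᵢ≢) wᵢ≡vᵢ) =
  separates⇒∉ᶜ C w (i∉ , λ eq → vᵢ≢ (trans (sym wᵢ≡vᵢ) eq))

shielded-toggle : ∀ {n} {C : Cube n} {w v j} → Shielded C w v → lookup w j ≢ lookup v j →
                  Shielded C (toggle w j) v
shielded-toggle {w = w} {j = j} (shielded i sep wᵢ≡vᵢ) wⱼ≢vⱼ with i ≟ᶠ j
... | yes refl = contradiction wᵢ≡vᵢ wⱼ≢vⱼ
... | no i≢j = shielded i sep (trans (toggle-other w i≢j) wᵢ≡vᵢ)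

approach⇒shielded : ∀ {n} {C : Cube n} {w v i} → ApproachesAt C w v i → Shielded C (toggle w i) v
approach⇒shielded {w = w} {i = i} (approaches sep wᵢ≢vᵢ) =
  shielded i sep (trans (toggle-same w i) (sym (¬-not (wᵢ≢vᵢ ∘ sym))))

shielded-or-approach : ∀ {n} (C : Cube n) w {v} → ¬ v ∈ᶜ C → Shielded C w v ⊎ ∃ (ApproachesAt C w v)
shielded-or-approach C w {v} v∉C with i , i∉ , vᵢ≢ ← ∉ᶜ⇒witness C v v∉C with lookup w i ≟ lookup v i
... | yes wᵢ≡vᵢ = inj₁ (shielded i (i∉ , vᵢ≢) wᵢ≡vᵢ)
... | no wᵢ≢vᵢ = inj₂ (i , approaches (i∉ , vᵢ≢) wᵢ≢vᵢ)

toggle-into-cube-unique : ∀ {n} (C : Cube n) u {x y} → ¬ u ∈ᶜ C →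
                          toggle u x ∈ᶜ C → toggle u y ∈ᶜ C → x ≡ y
toggle-into-cube-unique C u u∉C uₓ∈C u_y∈C with i , i∉ , uᵢ≢ ← ∉ᶜ⇒witness C u u∉C =
  trans (toggled-at-i uₓ∈C) (sym (toggled-at-i u_y∈C))
  where
  toggled-at-i : ∀ {x} → toggle u x ∈ᶜ C → x ≡ i
  toggled-at-i {x} uₓ∈C with x ≟ᶠ i
  ... | yes x≡i = x≡i
  ... | no x≢i = contradiction (trans (sym (toggle-other u (x≢i ∘ sym))) (uₓ∈C i i∉)) uᵢ≢

module _ {n} {S : Vertex n → Set} where

  step-towards : ∀ {w v} i → ¬ S w → lookup w i ≢ lookup v i →
                 Walk S (toggle w i) v (hamming (toggle w i) v) → Walk S w v (hamming w v)
  step-towards {w} {v} i w∉S wᵢ≢vᵢ walk =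
    subst (Walk S w v) (sym (hamming-toggle w v i wᵢ≢vᵢ)) (step w∉S (Adj-toggle w i) walk)

  geodesic : ∀ {v} (Inv : Vertex n → Set) → (∀ {w} → Inv w → ¬ S w) →
             (∀ {w i} → Inv w → lookup w i ≢ lookup v i → Inv (toggle w i)) →
             ∀ w → Inv w → Walk S w v (hamming w v)
  geodesic {v} Inv avoids preserved w inv = go (hamming w v) w refl inv
    where
    go : ∀ d w → hamming w v ≡ d → Inv w → Walk S w v (hamming w v)
    go zero w d≡0 inv with refl ← hamming≡0⇒≡ w v d≡0 = subst (Walk S v v) (sym d≡0) (here (avoids inv))
    go (suc d) w d≡1+d inv =
      let i , wᵢ≢vᵢ = hamming≡suc⇒differ w v d≡1+d
      in step-towards i (avoids inv) wᵢ≢vᵢ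
           (go d (toggle w i) (suc-injective (trans (sym (hamming-toggle w v i wᵢ≢vᵢ)) d≡1+d))
               (preserved inv wᵢ≢vᵢ))

  geodesic-≤1+n : ∀ {u v} → Walk S u v (hamming u v) → ∃ λ ℓ → ℓ ≤ suc n × Walk S u v ℓ
  geodesic-≤1+n {u} {v} walk = hamming u v , m≤n⇒m≤1+n (hamming≤n u v) , walk

module AvoidingTwoCubes {n} {S : Vertex n → Set} (A B : Cube n)
                        (covered : ∀ w → S w → w ∈ᶜ A ⊎ w ∈ᶜ B) where

  outside : ∀ {w} → ¬ w ∈ᶜ A → ¬ w ∈ᶜ B → ¬ S w
  outside w∉A w∉B w∈S = [ w∉A , w∉B ] (covered _ w∈S)

  walk-shielded-both : ∀ {w v} → Shielded A w v → Shielded B w v → Walk S w v (hamming w v)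
  walk-shielded-both {w} {v} shA shB = geodesic Inv avoids preserved w (shA , shB)
    where
    Inv : Vertex n → Set
    Inv w = Shielded A w v × Shielded B w v
    avoids : ∀ {w} → Inv w → ¬ S w
    avoids (shA , shB) = outside (shielded⇒∉ᶜ shA) (shielded⇒∉ᶜ shB)
    preserved : ∀ {w i} → Inv w → lookup w i ≢ lookup v i → Inv (toggle w i)
    preserved (shA , shB) wᵢ≢vᵢ = shielded-toggle shA wᵢ≢vᵢ , shielded-toggle shB wᵢ≢vᵢ

  walk-shielded : ∀ {w v} → Shielded A w v → ¬ w ∈ᶜ B → ¬ v ∈ᶜ B → Walk S w v (hamming w v)
  walk-shielded {w} shA w∉B v∉B with shielded-or-approach B w v∉B
  ... | inj₁ shB = walk-shielded-both shA shB
  ... | inj₂ (i , approach) = step-towards i (outside (shielded⇒∉ᶜ shA) w∉B) (differs approach)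
          (walk-shielded-both (shielded-toggle shA (differs approach)) (approach⇒shielded approach))

  walk-approach : ∀ {w v i} → ApproachesAt A w v i → ¬ w ∈ᶜ A → ¬ w ∈ᶜ B → ¬ toggle w i ∈ᶜ B →
                  ¬ v ∈ᶜ B → Walk S w v (hamming w v)
  walk-approach {i = i} approach w∉A w∉B wᵢ∉B v∉B =
    step-towards i (outside w∉A w∉B) (differs approach)
      (walk-shielded (approach⇒shielded approach) wᵢ∉B v∉B)

module _ {n} {S : Vertex n → Set} (A B : Cube n) (covered : ∀ w → S w → w ∈ᶜ A ⊎ w ∈ᶜ B) where
  private
    module AB = AvoidingTwoCubes A B covered
    module BA = AvoidingTwoCubes B A (λ w → swap ∘ covered w)

  -- Both one-step escapes from u lead into the other cube; the third fixed coordinate j of A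
  -- reopens the escape along y.
  walk-detour : ∀ {u v x y j} → j ∉ free A → j ≢ x → j ≢ y → ApproachesAt B u v y →
                toggle u x ∈ᶜ B → toggle u y ∈ᶜ A → ¬ u ∈ᶜ A → ¬ u ∈ᶜ B → ¬ v ∈ᶜ A →
                Walk S u v (suc (hamming (toggle u j) v))
  walk-detour {u} {v} {x} {y} {j} j∉A j≢x j≢y approachB uₓ∈B u_y∈A u∉A u∉B v∉A =
    step (AB.outside u∉A u∉B) (Adj-toggle u j)
         (BA.walk-approach (approaches (separates approachB) u′_y≢v_y) u′∉B u′∉A u′_y∉A v∉A)
    where
    open ApproachesAt using (separates)
    u′ = toggle u j
    u′ⱼ≢Aⱼ : lookup u′ j ≢ lookup (base A) j
    u′ⱼ≢Aⱼ eq = not-¬ refl (trans uⱼ≡Aⱼ (trans (sym eq) (toggle-same u j)))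
      where
      uⱼ≡Aⱼ : lookup u j ≡ lookup (base A) j
      uⱼ≡Aⱼ = trans (sym (toggle-other u j≢y)) (u_y∈A j j∉A)
    u′∉A : ¬ u′ ∈ᶜ A
    u′∉A = separates⇒∉ᶜ A u′ (j∉A , u′ⱼ≢Aⱼ)
    u′∉B : ¬ u′ ∈ᶜ B
    u′∉B u′∈B = j≢x (sym (toggle-into-cube-unique B u u∉B uₓ∈B u′∈B))
    u′_y≢v_y : lookup u′ y ≢ lookup v y
    u′_y≢v_y = differs approachB ∘ trans (sym (toggle-other u (j≢y ∘ sym)))
    u′_y∉A : ¬ toggle u′ y ∈ᶜ A
    u′_y∉A = separates⇒∉ᶜ A (toggle u′ y) (j∉A , u′ⱼ≢Aⱼ ∘ trans (sym (toggle-other u′ j≢y)))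

  diameter-two-cubes : Codim≥3 A → ∀ u v → ¬ u ∈ᶜ A → ¬ u ∈ᶜ B → ¬ v ∈ᶜ A → ¬ v ∈ᶜ B →
                       ∃ λ ℓ → ℓ ≤ suc n × Walk S u v ℓ
  diameter-two-cubes codimA u v u∉A u∉B v∉A v∉B
    with shielded-or-approach A u v∉A | shielded-or-approach B u v∉B
  ... | inj₁ shA | _ = geodesic-≤1+n (AB.walk-shielded shA u∉B v∉B)
  ... | inj₂ _ | inj₁ shB = geodesic-≤1+n (BA.walk-shielded shB u∉A v∉A)
  ... | inj₂ (x , approachA) | inj₂ (y , approachB) with toggle u x ∈ᶜ? B | toggle u y ∈ᶜ? A
  ... | no uₓ∉B | _ = geodesic-≤1+n (AB.walk-approach approachA u∉A u∉B uₓ∉B v∉B)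
  ... | yes _ | no u_y∉A = geodesic-≤1+n (BA.walk-approach approachB u∉B u∉A u_y∉A v∉A)
  ... | yes uₓ∈B | yes u_y∈A with j , j∉A , j≢x , j≢y ← codimA x y =
    suc (hamming (toggle u j) v) , s≤s (hamming≤n (toggle u j) v) ,
    walk-detour j∉A j≢x j≢y approachB uₓ∈B u_y∈A u∉A u∉B v∉A

SC⇒cube : ∀ {n m} (U : SC n m) → ∃ λ C → ∣ free C ∣ ≤ m × (∀ w → w ∈ᶜ C ⇔ proj₁ U w ≡ true)
SC⇒cube (U , k , k≤m , f , inj , img , adj) =
  let D , ∣D∣≤k , image = image-isCube k f inj (λ x y → Equivalence.to (adj x y))
  in cube D (f (replicate k false)) , ≤-trans ∣D∣≤k k≤m , λ w → ⇔.trans (image w) (⇔.sym (img w))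

diameter-two-subcubes : ∀ {m} {S : Vertex (3 + m) → Set} (U₁ U₂ : SC (3 + m) m) →
                        (∀ w → S w → proj₁ U₁ w ≡ true ⊎ proj₁ U₂ w ≡ true) →
                        ∀ u v → proj₁ U₁ u ≢ true → proj₁ U₂ u ≢ true →
                        proj₁ U₁ v ≢ true → proj₁ U₂ v ≢ true →
                        ∃ λ ℓ → ℓ ≤ 4 + m × Walk S u v ℓ
diameter-two-subcubes U₁ U₂ covered u v u∉U₁ u∉U₂ v∉U₁ v∉U₂ =
  diameter-two-cubes A B (λ w w∈S → Sum.map (from (A⇔U₁ w)) (from (B⇔U₂ w)) (covered w w∈S))
    (codim≥3 A (+-monoʳ-≤ 3 ∣A∣≤m)) u v
    (u∉U₁ ∘ to (A⇔U₁ u)) (u∉U₂ ∘ to (B⇔U₂ u)) (v∉U₁ ∘ to (A⇔U₁ v)) (v∉U₂ ∘ to (B⇔U₂ v))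
  where
  open Equivalence using (to; from)
  A = proj₁ (SC⇒cube U₁)
  ∣A∣≤m = proj₁ (proj₂ (SC⇒cube U₁))
  A⇔U₁ = proj₂ (proj₂ (SC⇒cube U₁))
  B = proj₁ (SC⇒cube U₂)
  B⇔U₂ = proj₂ (proj₂ (SC⇒cube U₂))

isPrefix : ∀ {j m} → Vertex j → Vertex (j + m) → Bool
isPrefix [] w = true
isPrefix (a ∷ p) (b ∷ w) = does (a ≟ b) ∧ isPrefix p w

isPrefix-++ : ∀ {j m} (p : Vertex j) (r : Vertex m) → isPrefix p (p ++ r) ≡ true
isPrefix-++ [] r = refl
isPrefix-++ (a ∷ p) r with a ≟ a
... | yes _ = isPrefix-++ p r
... | no a≢a = contradiction refl a≢a

isPrefix⇒++ : ∀ {j m} (p : Vertex j) (w : Vertex (j + m)) → isPrefix p w ≡ true → ∃ λ r → p ++ r ≡ w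
isPrefix⇒++ [] w _ = w , refl
isPrefix⇒++ (a ∷ p) (b ∷ w) h with a ≟ b
... | yes refl = let r , eq = isPrefix⇒++ p w h in r , cong (a ∷_) eq

prefixCube : ∀ {j} m → Vertex j → SC (j + m) m
prefixCube m p =
  isPrefix p , m , ≤-refl , p ++_ , (λ x y → ++-injectiveʳ p p) ,
  (λ w → mk⇔ (isPrefix⇒++ p w) λ { (r , refl) → isPrefix-++ p r }) ,
  λ x y → mk⇔ (trans (hamming-++ p x y)) (trans (sym (hamming-++ p x y)))

prefixCubes-disjoint : ∀ {j m} (p q : Vertex j) → (∀ r → isPrefix q (p ++ r) ≡ false) →
                       Disjoint (prefixCube m p) (prefixCube m q)
prefixCubes-disjoint p q q∤p w w∈ with r , refl ← isPrefix⇒++ p w w∈ = q∤p r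

module OriginCut (m : ℕ) where

  neighbourFacets : List (SC (3 + m) m)
  neighbourFacets = prefixCube m (true ∷ false ∷ false ∷ [])
                  ∷ prefixCube m (false ∷ true ∷ false ∷ [])
                  ∷ prefixCube m (false ∷ false ∷ true ∷ []) ∷ []

  pairwise-disjoint : PairwiseDisjoint neighbourFacets
  pairwise-disjoint =
    (prefixCubes-disjoint _ _ (λ _ → refl) ∷ prefixCubes-disjoint _ _ (λ _ → refl) ∷ []) ∷
    (prefixCubes-disjoint _ _ (λ _ → refl) ∷ []) ∷ [] ∷ []

  data InOriginFacet : Vertex (3 + m) → Set where
    origin-facet : ∀ r → InOriginFacet (false ∷ false ∷ false ∷ r)

  origin-facet-closed : ∀ r w → Adj (false ∷ false ∷ false ∷ r) w → ¬ Deleted neighbourFacets w →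
                        InOriginFacet w
  origin-facet-closed r (false ∷ false ∷ false ∷ w) _ _ = origin-facet w
  origin-facet-closed r (true ∷ false ∷ false ∷ w) _ w∉ = ⊥-elim (w∉ (here refl))
  origin-facet-closed r (false ∷ true ∷ false ∷ w) _ w∉ = ⊥-elim (w∉ (there (here refl)))
  origin-facet-closed r (false ∷ false ∷ true ∷ w) _ w∉ = ⊥-elim (w∉ (there (there (here refl))))
  origin-facet-closed r (true ∷ true ∷ _ ∷ w) () _
  origin-facet-closed r (true ∷ false ∷ true ∷ w) () _
  origin-facet-closed r (false ∷ true ∷ true ∷ w) () _

  walk-stays-in-origin-facet : ∀ {w v ℓ} → Walk (Deleted neighbourFacets) w v ℓ →
                               InOriginFacet w → InOriginFacet v
  walk-stays-in-origin-facet (here _) w∈ = w∈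
  walk-stays-in-origin-facet (step _ adj walk) (origin-facet r) =
    walk-stays-in-origin-facet walk (origin-facet-closed r _ adj (walk-start-∉ walk))

  disconnected : Disconnected (Deleted neighbourFacets)
  disconnected = replicate _ false , replicate _ true ,
    (λ { (here ()) ; (there (here ())) ; (there (there (here ()))) ; (there (there (there ()))) }) ,
    (λ { (here ()) ; (there (here ())) ; (there (there (here ()))) ; (there (there (there ()))) }) ,
    λ ℓ walk → case walk-stays-in-origin-facet walk (origin-facet _) of λ ()

  κ≤3 : ∀ {κ} → IsKappa (3 + m) m κ → κ ≤ 3
  κ≤3 (_ , minimal) = minimal neighbourFacets pairwise-disjoint disconnected

diameter-bound : ∀ m → DscfLe (3 + m) m (4 + m)
diameter-bound m κ isκ F _ 1+|F|≤κ u v u∉F v∉F with F | ≤-trans 1+|F|≤κ (OriginCut.κ≤3 m isκ)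
... | [] | _ = geodesic-≤1+n (geodesic (λ _ → Unit) (λ _ ()) (λ _ _ → tt) u tt)
... | U ∷ [] | _ =
  diameter-two-subcubes U U (λ { w (here w∈U) → inj₁ w∈U }) u v
    (u∉F ∘ here) (u∉F ∘ here) (v∉F ∘ here) (v∉F ∘ here)
... | U₁ ∷ U₂ ∷ [] | _ =
  diameter-two-subcubes U₁ U₂ (λ { w (here w∈U₁) → inj₁ w∈U₁ ; w (there (here w∈U₂)) → inj₂ w∈U₂ }) u v
    (u∉F ∘ here) (u∉F ∘ there ∘ here) (v∉F ∘ here) (v∉F ∘ there ∘ here)
... | _ ∷ _ ∷ _ ∷ _ | s≤s (s≤s (s≤s ()))

lemma4p2 : ∀ (m : ℕ) → DscfLe (m + 3) m (m + 4)
lemma4p2 m = subst₂ (λ n d → DscfLe n m d) (+-comm 3 m) (+-comm 4 m) (diameter-bound m)
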